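{- Let $\mathsf{f} :: \sigma_1 \Rightarrow \dots \Rightarrow \sigma_m \Rightarrow \iota$ be a function symbol and $s_1 :: \sigma_1, \dots, s_n :: \sigma_n$ terms ($n \le m$) such that: (1) every function symbol $\mathsf{g}$ with $\mathsf{f} \rhd \mathsf{g}$ is computable; (2) $s_i$ is computable for every $i \in \pi(\mathsf{f})$ with $i \le n$; and (3) whenever $\mathsf{g}$ is a function symbol with $\mathsf{f} \equiv \mathsf{g}$ and $t_1,\dots,t_k$ are terms such that $\mathsf{g}\ t_1 \cdots t_k$ is well-typed and $[s_i \mid i \in \pi(\mathsf{f}), i \le n]\ (\approx,\sqsupset)_{\mathtt{lex}}\ [t_i \mid i \in \pi(\mathsf{g}), i \le k]$, the term $\mathsf{g}\ t_1 \cdots t_k$ is terminating. Then every term $t$ with $\mathsf{f}\ s_1 \cdots s_n \sqsupset\!\!\sqsupset t$ is computable.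
   Context: Simply typed terms: there is a single base type (sort) $\iota$; types are $\iota$ and $\sigma \Rightarrow \tau$. Given a set of typed variables (infinitely many of each type) and a possibly infinite set of typed function symbols, terms are built from variables and function symbols by type-respecting application: if $s :: \sigma \Rightarrow \tau$ and $t :: \sigma$ then $s\ t :: \tau$ (left-associative). Every term has the form $a\ s_1 \cdots s_n$ ($n\ge 0$) with $a$ a variable or function symbol. Fixed data: a precedence $\unrhd$ (a quasi-ordering on function symbols whose strict part $\rhd$ is well-founded; $\equiv$ denotes $\unrhd \cap \unlhd$), and a filter $\pi$ assigning to each $\mathsf{f} :: \sigma_1 \Rightarrow \dots \Rightarrow \sigma_m \Rightarrow \iota$ a set $\pi(\mathsf{f}) \subseteq \{1,\dots,m\}$; for each $\mathsf{f}$ the arities of the symbols $\mathsf{g} \equiv \mathsf{f}$ are bounded. Equivalence: $s \approx t$ iff $s,t$ have the same type and either (Eq-mono) $s = x\ s_1 \cdots s_n$, $t = x\ t_1 \cdots t_n$, $x$ a variable, $s_i \approx t_i$ for all $i$; or (Eq-args) $s = \mathsf{f}\ s_1 \cdots s_n$, $t = \mathsf{g}\ t_1 \cdots t_n$, $\mathsf{f},\mathsf{g}$ function symbols of the same type, $\mathsf{f} \equiv \mathsf{g}$, $\pi(\mathsf{f}) = \pi(\mathsf{g})$, $s_i \approx t_i$ for all $i \in \pi(\mathsf{f}) \cap \{1,\dots,n\}$. The relations $\sqsupseteq, \sqsupset, \sqsupset\!\!\sqsupset$ are the least relations such that: $s \sqsupseteq t$ iff $s \approx t$ or $s \sqsupset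 t$. $s \sqsupset t$ if $s,t$ have the same type and one of: (Gr-mono) $s = x\ s_1 \cdots s_n$, $t = x\ t_1 \cdots t_n$, $x$ a variable, $s_i \sqsupseteq t_i$ for all $i$ and $s_i \sqsupset t_i$ for some $i$; (Gr-args) $s = \mathsf{f}\ s_1 \cdots s_n$, $t = \mathsf{g}\ t_1 \cdots t_n$, $\mathsf{f},\mathsf{g}$ of the same type, $\mathsf{f} \equiv \mathsf{g}$, $\pi(\mathsf{f}) = \pi(\mathsf{g})$, $s_i \sqsupseteq t_i$ for all $i \in \pi(\mathsf{f}) \cap \{1,\dots,n\}$ and $s_i \sqsupset t_i$ for some such $i$; (Gr-rpo) $s \sqsupset\!\!\sqsupset t$. $s \sqsupset\!\!\sqsupset t$ ($s,t$ possibly of different types) if $s = \mathsf{f}\ s_1 \cdots s_n$ with $\mathsf{f} :: \sigma_1 \Rightarrow \dots \Rightarrow \sigma_m \Rightarrow \iota$, $\{n+1,\dots,m\} \subseteq \pi(\mathsf{f})$, and one of: (Rpo-select) $s_i \sqsupseteq t$ for some $i \in \pi(\mathsf{f}) \cap \{1,\dots,n\}$; (Rpo-appl) $t = t_0\ t_1 \cdots t_k$ with $k \ge 1$ and $s \sqsupset\!\!\sqsupset t_i$ for all $0 \le i \le k$; (Rpo-copy) $t = \mathsf{g}\ t_1 \cdots t_k$ with $\mathsf{f} \rhd \mathsf{g}$ and $s \sqsupset\!\!\sqsupset t_i$ for all $i \in \pi(\mathsf{g}) \cap \{1,\dots,k\}$; (Rpo-lex) $t = \mathsf{g}\ t_1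 \cdots t_k$ with $\mathsf{f} \equiv \mathsf{g}$ and there is $i \in \pi(\mathsf{f}) \cap \pi(\mathsf{g}) \cap \{1,\dots,\min(n,k)\}$ with $\pi(\mathsf{f}) \cap \{1,\dots,i\} = \pi(\mathsf{g}) \cap \{1,\dots,i\}$, $s_j \approx t_j$ for all $j \in \{1,\dots,i-1\} \cap \pi(\mathsf{f})$, $s_i \sqsupset t_i$, and $s \sqsupset\!\!\sqsupset t_j$ for all $j \in \{i+1,\dots,k\} \cap \pi(\mathsf{g})$. A term $s$ is terminating if there is no infinite sequence $s \sqsupset s_1 \sqsupset s_2 \sqsupset \cdots$. By induction on types: a term $s :: \sigma_1 \Rightarrow \dots \Rightarrow \sigma_m \Rightarrow \iota$ is computable if for all computable $t_1 :: \sigma_1, \dots, t_m :: \sigma_m$ the term $s\ t_1 \cdots t_m$ is terminating; a function symbol is computable if it is computable as a term. Lexicographic extension: for finite sequences of terms (listed in increasing order of index), $[a_1,\dots,a_p]\ (\approx,\sqsupset)_{\mathtt{lex}}\ [b_1,\dots,b_q]$ holds iff there is $i \le \min(p,q)$ with $a_j \approx b_j$ for all $j < i$ and $a_i \sqsupset b_i$. -}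

module Defs where

open import Data.Nat using (ℕ; zero; suc; _≤_; _<_; _⊔_)
open import Data.Nat.Properties using ()
open import Data.Bool using (Bool; true; false; if_then_else_)
open import Data.List using (List; []; _∷_; _++_; [_]; length)
open import Data.List.Relation.Unary.All using (All)
open import Data.List.Relation.Binary.Pointwise using (Pointwise)
open import Data.Product using (Σ; ∃; _×_; _,_)
open import Relation.Nullary using (¬_)
open import Relation.Binary.PropositionalEquality using (_≡_)
open import Relation.Binary.Structures using (IsPreorder)
open import Induction.WellFounded using (WellFounded; Acc)

infixr 5 _⇒_
data Ty : Set where
  ι   : Ty
  _⇒_ : Ty → Ty → Ty

arity : Ty → ℕ
arity ι       = 0
arity (σ ⇒ τ) = suc (arity τ)

-- The fixed data: function symbols with types, a precedence ⊵
-- (quasi-ordering with well-founded strict part), a filter π, and the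
-- boundedness of arities inside each ≡-class.
-- π f is represented by its characteristic function on ℕ (1-based
-- argument positions); π-range says π f ⊆ {1,…,m}.

record Signature : Set₁ where
  field
    Sym           : Set
    type          : Sym → Ty
    _⊵_           : Sym → Sym → Set
    ⊵-isPreorder  : IsPreorder _≡_ _⊵_
    ▷-wellFounded : WellFounded (λ g f → (f ⊵ g) × ¬ (g ⊵ f))
    π             : Sym → ℕ → Bool
    π-range       : ∀ f i → π f i ≡ true → 1 ≤ i × i ≤ arity (type f)
    ≡-arity-bound : ∀ f → ∃ λ B → ∀ g → f ⊵ g → g ⊵ f → arity (type g) ≤ B

module Theory (S : Signature) where
  open Signature S public

  _▷_ : Sym → Sym → Set
  f ▷ g = (f ⊵ g) × ¬ (g ⊵ f)

  _≡ₚ_ : Sym → Sym → Set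
  f ≡ₚ g = (f ⊵ g) × (g ⊵ f)

  SamePi : Sym → Sym → Set
  SamePi f g = ∀ i → π f i ≡ π g i

  -- Terms, in spine form  a s₁ ⋯ sₙ  (a a variable or a function symbol).
  -- Variables: for each type σ, the variables  var σ x  (x : ℕ).

  data Head : Set where
    var : Ty → ℕ → Head
    fun : Sym → Head

  headTy : Head → Ty
  headTy (var σ x) = σ
  headTy (fun f)   = type f

  infix 6 _⟨_⟩
  data Tm : Set where
    _⟨_⟩ : Head → List Tm → Tm

  infixl 7 _·_
  _·_ : Tm → Tm → Tm
  (h ⟨ ss ⟩) · t = h ⟨ ss ++ [ t ] ⟩

  infix 4 _∶_
  mutual
    data _∶_ : Tm → Ty → Set where
      tm : ∀ {h ts τ} → ArgsTy (headTy h) ts τ → h ⟨ ts ⟩ ∶ τ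

    data ArgsTy : Ty → List Tm → Ty → Set where
      []  : ∀ {σ} → ArgsTy σ [] σ
      _∷_ : ∀ {α β t ts τ} → t ∶ α → ArgsTy β ts τ → ArgsTy (α ⇒ β) (t ∷ ts) τ

  SameTy : Tm → Tm → Set
  SameTy s t = Σ Ty λ σ → (s ∶ σ) × (t ∶ σ)

  -- At ts i t : the i-th (1-based) element of ts is t
  data At : List Tm → ℕ → Tm → Set where
    here  : ∀ {x xs} → At (x ∷ xs) 1 x
    there : ∀ {x xs i y} → At xs i y → At (x ∷ xs) (suc i) y

  infix 4 _≈_
  data _≈_ : Tm → Tm → Set where
    eq-mono : ∀ {σ x ss ts} → SameTy (var σ x ⟨ ss ⟩) (var σ x ⟨ ts ⟩) →
              Pointwise _≈_ ss ts →
              var σ x ⟨ ss ⟩ ≈ var σ x ⟨ ts ⟩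
    eq-args : ∀ {f g ss ts} → SameTy (fun f ⟨ ss ⟩) (fun g ⟨ ts ⟩) →
              type f ≡ type g → f ≡ₚ g → SamePi f g →
              (∀ i a b → π f i ≡ true → At ss i a → At ts i b → a ≈ b) →
              fun f ⟨ ss ⟩ ≈ fun g ⟨ ts ⟩

  TailInPi : Sym → List Tm → Set
  TailInPi f ss = ∀ i → length ss < i → i ≤ arity (type f) → π f i ≡ true

  infix 4 _⊒_ _⊐_ _⊐⊐_
  mutual
    data _⊒_ : Tm → Tm → Set where
      ⊒-≈ : ∀ {s t} → s ≈ t → s ⊒ t
      ⊒-⊐ : ∀ {s t} → s ⊐ t → s ⊒ t

    data _⊐_ : Tm → Tm → Set where
      gr-mono : ∀ {σ x ss ts} → SameTy (var σ x ⟨ ss ⟩) (var σ x ⟨ ts ⟩) →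
                Pointwise _⊒_ ss ts →
                (Σ ℕ λ i → Σ Tm λ a → Σ Tm λ b → At ss i a × At ts i b × a ⊐ b) →
                var σ x ⟨ ss ⟩ ⊐ var σ x ⟨ ts ⟩
      gr-args : ∀ {f g ss ts} → SameTy (fun f ⟨ ss ⟩) (fun g ⟨ ts ⟩) →
                type f ≡ type g → f ≡ₚ g → SamePi f g →
                (∀ i a b → π f i ≡ true → At ss i a → At ts i b → a ⊒ b) →
                (Σ ℕ λ i → Σ Tm λ a → Σ Tm λ b →
                   π f i ≡ true × At ss i a × At ts i b × a ⊐ b) →
                fun f ⟨ ss ⟩ ⊐ fun g ⟨ ts ⟩
      gr-rpo  : ∀ {s t} → SameTy s t → s ⊐⊐ t → s ⊐ t

    data _⊐⊐_ : Tm → Tm → Set where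
      rpo-select : ∀ {f ss t} → TailInPi f ss →
                   (Σ ℕ λ i → Σ Tm λ a → π f i ≡ true × At ss i a × a ⊒ t) →
                   fun f ⟨ ss ⟩ ⊐⊐ t
      rpo-appl   : ∀ {f ss h pre u post} → TailInPi f ss →
                   -- t = t₀ t₁ ⋯ tₖ with t₀ = h ⟨ pre ⟩, t₁ ⋯ tₖ = u ∷ post (k ≥ 1)
                   fun f ⟨ ss ⟩ ⊐⊐ h ⟨ pre ⟩ →
                   All (fun f ⟨ ss ⟩ ⊐⊐_) (u ∷ post) →
                   fun f ⟨ ss ⟩ ⊐⊐ h ⟨ pre ++ (u ∷ post) ⟩
      rpo-copy   : ∀ {f ss g ts} → TailInPi f ss → f ▷ g →
                   (∀ i u → π g i ≡ true → At ts i u → fun f ⟨ ss ⟩ ⊐⊐ u) →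
                   fun f ⟨ ss ⟩ ⊐⊐ fun g ⟨ ts ⟩
      rpo-lex    : ∀ {f ss g ts} → TailInPi f ss → f ≡ₚ g →
                   (i : ℕ) → π f i ≡ true → π g i ≡ true →
                   (∀ j → 1 ≤ j → j ≤ i → π f j ≡ π g j) →
                   (∀ j a b → j < i → π f j ≡ true → At ss j a → At ts j b → a ≈ b) →
                   (Σ Tm λ a → Σ Tm λ b → At ss i a × At ts i b × a ⊐ b) →
                   (∀ j u → i < j → π g j ≡ true → At ts j u → fun f ⟨ ss ⟩ ⊐⊐ u) →
                   fun f ⟨ ss ⟩ ⊐⊐ fun g ⟨ ts ⟩

  Terminating : Tm → Set
  Terminating = Acc (λ t s → s ⊐ t)

  Computable : Ty → Tm → Set
  Computable ι       s = Terminating s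
  Computable (σ ⇒ τ) s = ∀ t → t ∶ σ → Computable σ t → Computable τ (s · t)

  ComputableSym : Sym → Set
  ComputableSym g = Computable (type g) (fun g ⟨ [] ⟩)

  filterFrom : (ℕ → Bool) → ℕ → List Tm → List Tm
  filterFrom p i []       = []
  filterFrom p i (x ∷ xs) =
    if p i then x ∷ filterFrom p (suc i) xs else filterFrom p (suc i) xs

  filterπ : Sym → List Tm → List Tm
  filterπ f ss = filterFrom (π f) 1 ss

  -- lexicographic extension (≈, ⊐)_lex (no clause for unequal lengths
  -- beyond the common prefix: the decisive index is ≤ min(p,q))
  data Lex : List Tm → List Tm → Set where
    this : ∀ {a b as bs} → a ⊐ b → Lex (a ∷ as) (b ∷ bs)
    next : ∀ {a b as bs} → a ≈ b → Lex as bs → Lex (a ∷ as) (b ∷ bs)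

{-# OPTIONS --safe #-}
-- Induction on the derivation of f s⃗ ⊐⊐ t. Rpo-select: t is ⊒-below a computable argument, and computability is closed
-- under ⊒ because ≈ and ⊐ are monotone under application. Rpo-appl: computability is closed under
-- application. Rpo-copy: replacing the arguments of g t⃗ outside π(g) by variables changes it only
-- up to ≈, which termination respects, so the computable symbol g makes it computable; variables
-- are computable by the usual Tait argument, as a variable-headed term only decreases in its
-- arguments. Rpo-lex: every saturation g t⃗ u⃗ is lexicographically below f s⃗ on the filtered
-- arguments, hence terminates by (3).
module Submission where

open import Defs
open import Data.Nat using (ℕ; suc; pred; _+_; _≤_; _<_; z≤n; s≤s)
open import Data.Nat.Properties using (+-cancelʳ-≡; n<1+n; m<m+n; ≤-trans; ≤-reflexive)
open import Data.Bool using (Bool; true; false; if_then_else_)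
open import Data.List using (List; []; _∷_; _++_; [_]; length)
open import Data.List.Properties using (++-assoc; ++-identityʳ; length-++-≤ˡ)
open import Data.List.Relation.Unary.All using (All; []; _∷_)
open import Data.List.Relation.Unary.All.Properties using () renaming (++⁺ to All-++⁺)
open import Data.List.Relation.Binary.Pointwise using (Pointwise; []; _∷_) renaming (++⁺ to Pointwise-++⁺)
open import Data.Product using (∃; _×_; _,_)
open import Data.Sum using (_⊎_; inj₁; inj₂)
open import Relation.Nullary using (contradiction)
open import Relation.Unary using (_⊆_)
open import Relation.Binary.PropositionalEquality using (_≡_; refl; sym; trans; cong; subst)
open import Relation.Binary.Structures using (IsPreorder)
open import Induction.WellFounded using (Acc; acc)

module Computability (S : Signature) where
  open Theory S

  variable
    a b c u : Tm
    xs ys zs us ss ts : List Tm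
    ρ σ τ α β : Ty
    i j : ℕ
    f g h : Sym
    hd : Head

  ArgsTy-unique : ArgsTy ρ ts σ → ArgsTy ρ ts τ → σ ≡ τ
  ArgsTy-unique [] [] = refl
  ArgsTy-unique (_ ∷ p) (_ ∷ q) = ArgsTy-unique p q

  ∶-unique : a ∶ σ → a ∶ τ → σ ≡ τ
  ∶-unique (tm p) (tm q) = ArgsTy-unique p q

  arity-ArgsTy : ArgsTy ρ ts σ → arity ρ ≡ length ts + arity σ
  arity-ArgsTy [] = refl
  arity-ArgsTy (_ ∷ p) = cong suc (arity-ArgsTy p)

  ArgsTy-length : ArgsTy ρ xs σ → ArgsTy ρ ys σ → length xs ≡ length ys
  ArgsTy-length {σ = σ} p q = +-cancelʳ-≡ (arity σ) _ _ (trans (sym (arity-ArgsTy p)) (arity-ArgsTy q))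

  ArgsTy-++ : ArgsTy ρ xs τ → ArgsTy τ ys σ → ArgsTy ρ (xs ++ ys) σ
  ArgsTy-++ [] q = q
  ArgsTy-++ (x∶ ∷ p) q = x∶ ∷ ArgsTy-++ p q

  ArgsTy-split : ∀ xs → ArgsTy ρ (xs ++ ys) σ → ∃ λ τ → ArgsTy ρ xs τ × ArgsTy τ ys σ
  ArgsTy-split [] p = _ , [] , p
  ArgsTy-split (x ∷ xs) (x∶ ∷ p) with ArgsTy-split xs p
  ... | τ , p₁ , p₂ = τ , x∶ ∷ p₁ , p₂

  ·-∶ : a ∶ α ⇒ β → u ∶ α → a · u ∶ β
  ·-∶ {a = _ ⟨ _ ⟩} (tm p) u∶ = tm (ArgsTy-++ p (u∶ ∷ []))

  SameTy-sym : SameTy a b → SameTy b a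
  SameTy-sym (σ , a∶ , b∶) = σ , b∶ , a∶

  SameTy-trans : SameTy a b → SameTy b c → SameTy a c
  SameTy-trans {c = c} (σ , a∶ , b∶) (_ , b∶′ , c∶) = σ , a∶ , subst (c ∶_) (∶-unique b∶′ b∶) c∶

  SameTy-∶ : SameTy a b → a ∶ σ → b ∶ σ
  SameTy-∶ {b = b} (_ , a∶′ , b∶) a∶ = subst (b ∶_) (∶-unique a∶′ a∶) b∶

  SameTy-· : SameTy a b → a ∶ α ⇒ β → u ∶ α → SameTy (a · u) (b · u)
  SameTy-· st a∶ u∶ = _ , ·-∶ a∶ u∶ , ·-∶ (SameTy-∶ st a∶) u∶

  args-length : SameTy (fun f ⟨ ss ⟩) (fun g ⟨ ts ⟩) → type f ≡ type g → length ss ≡ length ts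
  args-length {ts = ts} (σ , tm p , tm q) e = ArgsTy-length p (subst (λ ρ → ArgsTy ρ ts σ) (sym e) q)

  At-unique : At xs i a → At xs i b → a ≡ b
  At-unique here here = refl
  At-unique (there p) (there q) = At-unique p q

  At-pos : At xs i a → 1 ≤ i
  At-pos here = s≤s z≤n
  At-pos (there _) = s≤s z≤n

  At-++ˡ : At xs i a → At (xs ++ ys) i a
  At-++ˡ here = here
  At-++ˡ (there p) = there (At-++ˡ p)

  At-++⁻ˡ : At xs i b → j < i → At (xs ++ ys) j a → At xs j a
  At-++⁻ˡ (there _) _ here = here
  At-++⁻ˡ (there p) (s≤s j<i) (there q) = there (At-++⁻ˡ p j<i q)
  At-++⁻ˡ here (s≤s z≤n) ()

  At-last : ∀ xs → At (xs ++ [ u ]) (suc (length xs)) u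
  At-last [] = here
  At-last (_ ∷ xs) = there (At-last xs)

  At-transfer : length xs ≡ length ys → At xs i a → ∃ (At ys i)
  At-transfer {ys = y ∷ _} _ here = y , here
  At-transfer {ys = _ ∷ _} e (there p) with At-transfer (cong pred e) p
  ... | b , q = b , there q

  At-Pointwise : ∀ {R : Tm → Tm → Set} → Pointwise R xs ys → At ys i b → ∃ λ a → At xs i a × R a b
  At-Pointwise (r ∷ _) here = _ , here , r
  At-Pointwise (_ ∷ rs) (there p) with At-Pointwise rs p
  ... | a , q , r = a , there q , r

  PointwiseOn : (ℕ → Set) → (Tm → Tm → Set) → List Tm → List Tm → Set
  PointwiseOn P R xs ys = ∀ i a b → P i → At xs i a → At ys i b → R a b

  PointwiseOn-++ : ∀ {P R} → length xs ≡ length ys → PointwiseOn P R xs ys →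
                   (∀ {j x} → At us j x → R x x) → PointwiseOn P R (xs ++ us) (ys ++ us)
  PointwiseOn-++ {xs = []} {ys = []} {R = R} _ _ r i a b _ p q = subst (R a) (At-unique p q) (r p)
  PointwiseOn-++ {xs = _ ∷ _} {ys = _ ∷ _} _ H _ _ a b Pi here here = H 1 a b Pi here here
  PointwiseOn-++ {xs = _ ∷ _} {ys = _ ∷ _} {P = P} e H r (suc i) a b Pi (there p) (there q) =
    PointwiseOn-++ {P = λ i → P (suc i)} (cong pred e)
      (λ i a b Pi p q → H (suc i) a b Pi (there p) (there q)) r i a b Pi p q

  module ⊵ = IsPreorder ⊵-isPreorder

  ≡ₚ-refl : f ≡ₚ f
  ≡ₚ-refl = ⊵.refl , ⊵.refl

  ≡ₚ-trans : f ≡ₚ g → g ≡ₚ h → f ≡ₚ h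
  ≡ₚ-trans (f⊵g , g⊵f) (g⊵h , h⊵g) = ⊵.trans f⊵g g⊵h , ⊵.trans h⊵g g⊵f

  ≡ₚ-▷-trans : f ≡ₚ g → g ▷ h → f ▷ h
  ≡ₚ-▷-trans (f⊵g , g⊵f) (g⊵h , h⋬g) = ⊵.trans f⊵g g⊵h , λ h⊵f → h⋬g (⊵.trans h⊵f f⊵g)

  -- The equivalence ≈ and its compatibility with ⊐

  ≈-SameTy : a ≈ b → SameTy a b
  ≈-SameTy (eq-mono st _) = st
  ≈-SameTy (eq-args st _ _ _ _) = st

  ⊐-SameTy : a ⊐ b → SameTy a b
  ⊐-SameTy (gr-mono st _ _) = st
  ⊐-SameTy (gr-args st _ _ _ _ _) = st
  ⊐-SameTy (gr-rpo st _) = st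

  ⊒-SameTy : a ⊒ b → SameTy a b
  ⊒-SameTy (⊒-≈ a≈b) = ≈-SameTy a≈b
  ⊒-SameTy (⊒-⊐ a⊐b) = ⊐-SameTy a⊐b

  mutual
    ≈-refl : a ∶ σ → a ≈ a
    ≈-refl (tm {var _ _} p) = eq-mono (_ , tm p , tm p) (≈-refl-Pointwise p)
    ≈-refl (tm {fun _} p) = eq-args (_ , tm p , tm p) refl ≡ₚ-refl (λ _ → refl)
      (λ _ a _ _ p₁ p₂ → subst (a ≈_) (At-unique p₁ p₂) (≈-refl-At p p₁))

    ≈-refl-Pointwise : ArgsTy ρ ts σ → Pointwise _≈_ ts ts
    ≈-refl-Pointwise [] = []
    ≈-refl-Pointwise (t∶ ∷ p) = ≈-refl t∶ ∷ ≈-refl-Pointwise p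

    ≈-refl-At : ArgsTy ρ ts σ → At ts i a → a ≈ a
    ≈-refl-At (t∶ ∷ _) here = ≈-refl t∶
    ≈-refl-At (_ ∷ p) (there q) = ≈-refl-At p q

  mutual
    ≈-trans : a ≈ b → b ≈ c → a ≈ c
    ≈-trans (eq-mono st p) (eq-mono st′ q) = eq-mono (SameTy-trans st st′) (≈-trans-Pointwise p q)
    ≈-trans (eq-args st e f≡g sp H) (eq-args st′ e′ g≡h sp′ H′) =
      eq-args (SameTy-trans st st′) (trans e e′) (≡ₚ-trans f≡g g≡h) (λ i → trans (sp i) (sp′ i))
        (λ i a c Pi ai ci → let (b , bi) = At-transfer (args-length st e) ai in
           ≈-trans (H i a b Pi ai bi) (H′ i b c (trans (sym (sp i)) Pi) bi ci))

    ≈-trans-Pointwise : Pointwise _≈_ xs ys → Pointwise _≈_ ys zs → Pointwise _≈_ xs zs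
    ≈-trans-Pointwise [] [] = []
    ≈-trans-Pointwise (p ∷ ps) (q ∷ qs) = ≈-trans p q ∷ ≈-trans-Pointwise ps qs

  TailInPi-≈ : SameTy (fun f ⟨ ss ⟩) (fun g ⟨ ts ⟩) → type f ≡ type g → SamePi f g →
               TailInPi g ts → TailInPi f ss
  TailInPi-≈ st e sp tail i n<i i≤m =
    trans (sp i) (tail i (subst (_< i) (args-length st e) n<i) (subst (λ ρ → i ≤ arity ρ) e i≤m))

  mutual
    ≈-⊒-trans : a ≈ b → b ⊒ c → a ⊒ c
    ≈-⊒-trans a≈b (⊒-≈ b≈c) = ⊒-≈ (≈-trans a≈b b≈c)
    ≈-⊒-trans a≈b (⊒-⊐ b⊐c) = ⊒-⊐ (≈-⊐-trans a≈b b⊐c)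

    ≈-⊒-trans-Pointwise : Pointwise _≈_ xs ys → Pointwise _⊒_ ys zs → Pointwise _⊒_ xs zs
    ≈-⊒-trans-Pointwise [] [] = []
    ≈-⊒-trans-Pointwise (p ∷ ps) (q ∷ qs) = ≈-⊒-trans p q ∷ ≈-⊒-trans-Pointwise ps qs

    ≈-⊐-trans : a ≈ b → b ⊐ c → a ⊐ c
    ≈-⊐-trans (eq-mono st p) (gr-mono st′ q (i , b , c , bi , ci , b⊐c)) =
      let (a , ai , a≈b) = At-Pointwise p bi in
      gr-mono (SameTy-trans st st′) (≈-⊒-trans-Pointwise p q) (i , a , c , ai , ci , ≈-⊐-trans a≈b b⊐c)
    ≈-⊐-trans (eq-args st e f≡g sp H) (gr-args st′ e′ g≡h sp′ H′ (i , b , c , Pi , bi , ci , b⊐c)) =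
      let (a , ai) = At-transfer (sym (args-length st e)) bi in
      gr-args (SameTy-trans st st′) (trans e e′) (≡ₚ-trans f≡g g≡h) (λ i → trans (sp i) (sp′ i))
        (λ j a c Pj aj cj → let (b , bj) = At-transfer (args-length st e) aj in
           ≈-⊒-trans (H j a b Pj aj bj) (H′ j b c (trans (sym (sp j)) Pj) bj cj))
        (i , a , c , trans (sp i) Pi , ai , ci , ≈-⊐-trans (H i a b (trans (sp i) Pi) ai bi) b⊐c)
    ≈-⊐-trans a≈b (gr-rpo st b⊐⊐c) = gr-rpo (SameTy-trans (≈-SameTy a≈b) st) (≈-⊐⊐-trans a≈b b⊐⊐c)

    ≈-⊐⊐-trans : a ≈ b → b ⊐⊐ c → a ⊐⊐ c
    ≈-⊐⊐-trans (eq-args st e _ sp H) (rpo-select tail (i , b , Pi , bi , b⊒c)) =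
      let (a , ai) = At-transfer (sym (args-length st e)) bi in
      rpo-select (TailInPi-≈ st e sp tail)
        (i , a , trans (sp i) Pi , ai , ≈-⊒-trans (H i a b (trans (sp i) Pi) ai bi) b⊒c)
    ≈-⊐⊐-trans E@(eq-args st e _ sp _) (rpo-appl tail d ds) =
      rpo-appl (TailInPi-≈ st e sp tail) (≈-⊐⊐-trans E d) (≈-⊐⊐-trans-All E ds)
    ≈-⊐⊐-trans E@(eq-args st e f≡g sp _) (rpo-copy tail g▷h K) =
      rpo-copy (TailInPi-≈ st e sp tail) (≡ₚ-▷-trans f≡g g▷h) (λ i u Pi ui → ≈-⊐⊐-trans E (K i u Pi ui))
    ≈-⊐⊐-trans E@(eq-args st e f≡g sp H)
               (rpo-lex tail g≡h i Pgi Phi agree below (b , c , bi , ci , b⊐c) above) =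
      let (a , ai) = At-transfer (sym (args-length st e)) bi in
      rpo-lex (TailInPi-≈ st e sp tail) (≡ₚ-trans f≡g g≡h) i (trans (sp i) Pgi) Phi
        (λ j 1≤j j≤i → trans (sp j) (agree j 1≤j j≤i))
        (λ j a c j<i Pj aj cj → let (b , bj) = At-transfer (args-length st e) aj in
           ≈-trans (H j a b Pj aj bj) (below j b c j<i (trans (sym (sp j)) Pj) bj cj))
        (a , c , ai , ci , ≈-⊐-trans (H i a b (trans (sp i) Pgi) ai bi) b⊐c)
        (λ j u i<j Pj uj → ≈-⊐⊐-trans E (above j u i<j Pj uj))

    ≈-⊐⊐-trans-All : a ≈ b → All (b ⊐⊐_) xs → All (a ⊐⊐_) xs
    ≈-⊐⊐-trans-All _ [] = []
    ≈-⊐⊐-trans-All a≈b (d ∷ ds) = ≈-⊐⊐-trans a≈b d ∷ ≈-⊐⊐-trans-All a≈b ds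

  ⊐⊐-TailInPi : fun f ⟨ ss ⟩ ⊐⊐ a → TailInPi f ss
  ⊐⊐-TailInPi (rpo-select tail _) = tail
  ⊐⊐-TailInPi (rpo-appl tail _ _) = tail
  ⊐⊐-TailInPi (rpo-copy tail _ _) = tail
  ⊐⊐-TailInPi (rpo-lex tail _ _ _ _ _ _ _ _) = tail

  TailInPi-++ : ∀ ss us → TailInPi f ss → TailInPi f (ss ++ us)
  TailInPi-++ ss _ tail i n<i = tail i (≤-trans (s≤s (length-++-≤ˡ ss)) n<i)

  mutual
    ⊐⊐-++ : ∀ us → fun f ⟨ ss ⟩ ⊐⊐ a → fun f ⟨ ss ++ us ⟩ ⊐⊐ a
    ⊐⊐-++ {ss = ss} us (rpo-select tail (i , b , Pi , bi , b⊒a)) =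
      rpo-select (TailInPi-++ ss us tail) (i , b , Pi , At-++ˡ bi , b⊒a)
    ⊐⊐-++ {ss = ss} us (rpo-appl tail d ds) =
      rpo-appl (TailInPi-++ ss us tail) (⊐⊐-++ us d) (⊐⊐-++-All us ds)
    ⊐⊐-++ {ss = ss} us (rpo-copy tail f▷g K) =
      rpo-copy (TailInPi-++ ss us tail) f▷g (λ i u Pi ui → ⊐⊐-++ us (K i u Pi ui))
    ⊐⊐-++ {ss = ss} us (rpo-lex tail f≡g i Pfi Pgi agree below (b , c , bi , ci , b⊐c) above) =
      rpo-lex (TailInPi-++ ss us tail) f≡g i Pfi Pgi agree
        (λ j a c j<i Pj aj cj → below j a c j<i Pj (At-++⁻ˡ bi j<i aj) cj)
        (b , c , At-++ˡ bi , ci , b⊐c)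
        (λ j u i<j Pj uj → ⊐⊐-++ us (above j u i<j Pj uj))

    ⊐⊐-++-All : ∀ us → All (fun f ⟨ ss ⟩ ⊐⊐_) xs → All (fun f ⟨ ss ++ us ⟩ ⊐⊐_) xs
    ⊐⊐-++-All _ [] = []
    ⊐⊐-++-All us (d ∷ ds) = ⊐⊐-++ us d ∷ ⊐⊐-++-All us ds

  -- f s⃗ u ⊐⊐ u by Rpo-select: the position of u is filtered by the side condition of f s⃗ ⊐⊐ a.
  ⊐⊐-· : fun f ⟨ ss ⟩ ⊐⊐ a → fun f ⟨ ss ⟩ ∶ α ⇒ β → u ∶ α → fun f ⟨ ss ++ [ u ] ⟩ ⊐⊐ a · u
  ⊐⊐-· {f = f} {ss = ss} {a = _ ⟨ _ ⟩} {u = u} d (tm p) u∶ =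
    rpo-appl tail (⊐⊐-++ [ u ] d)
      (rpo-select tail (suc (length ss) , u , u-filtered , At-last ss , ⊒-≈ (≈-refl u∶)) ∷ [])
    where
    tail : TailInPi f (ss ++ [ u ])
    tail = TailInPi-++ ss [ u ] (⊐⊐-TailInPi d)
    u-filtered : π f (suc (length ss)) ≡ true
    u-filtered = ⊐⊐-TailInPi d (suc (length ss)) (n<1+n (length ss))
                   (≤-trans (m<m+n (length ss) (s≤s z≤n)) (≤-reflexive (sym (arity-ArgsTy p))))

  ≈-· : a ≈ b → a ∶ α ⇒ β → u ∶ α → a · u ≈ b · u
  ≈-· (eq-mono st p) a∶ u∶ = eq-mono (SameTy-· st a∶ u∶) (Pointwise-++⁺ p (≈-refl u∶ ∷ []))
  ≈-· (eq-args st e f≡g sp H) a∶ u∶ =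
    eq-args (SameTy-· st a∶ u∶) e f≡g sp
      (PointwiseOn-++ (args-length st e) H λ { here → ≈-refl u∶ ; (there ()) })

  ⊐-· : a ⊐ b → a ∶ α ⇒ β → u ∶ α → a · u ⊐ b · u
  ⊐-· (gr-mono st p (i , a , b , ai , bi , a⊐b)) a∶ u∶ =
    gr-mono (SameTy-· st a∶ u∶) (Pointwise-++⁺ p (⊒-≈ (≈-refl u∶) ∷ []))
      (i , a , b , At-++ˡ ai , At-++ˡ bi , a⊐b)
  ⊐-· (gr-args st e f≡g sp H (i , a , b , Pi , ai , bi , a⊐b)) a∶ u∶ =
    gr-args (SameTy-· st a∶ u∶) e f≡g sp
      (PointwiseOn-++ (args-length st e) H λ { here → ⊒-≈ (≈-refl u∶) ; (there ()) })
      (i , a , b , Pi , At-++ˡ ai , At-++ˡ bi , a⊐b)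
  ⊐-· {a = fun _ ⟨ _ ⟩} (gr-rpo st d) a∶ u∶ = gr-rpo (SameTy-· st a∶ u∶) (⊐⊐-· d a∶ u∶)

  ⊒-· : a ⊒ b → a ∶ α ⇒ β → u ∶ α → a · u ⊒ b · u
  ⊒-· (⊒-≈ a≈b) a∶ u∶ = ⊒-≈ (≈-· a≈b a∶ u∶)
  ⊒-· (⊒-⊐ a⊐b) a∶ u∶ = ⊒-⊐ (⊐-· a⊐b a∶ u∶)

  Terminating-≈ : a ≈ b → Terminating a → Terminating b
  Terminating-≈ a≈b (acc rs) = acc λ b⊐c → rs (≈-⊐-trans a≈b b⊐c)

  Terminating-⊒ : a ⊒ b → Terminating a → Terminating b
  Terminating-⊒ (⊒-≈ a≈b) = Terminating-≈ a≈b
  Terminating-⊒ (⊒-⊐ a⊐b) (acc rs) = rs a⊐b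

  Terminating-·⁻¹ : a ∶ α ⇒ β → u ∶ α → Terminating (a · u) → Terminating a
  Terminating-·⁻¹ a∶ u∶ (acc rs) =
    acc λ a⊐b → Terminating-·⁻¹ (SameTy-∶ (⊐-SameTy a⊐b) a∶) u∶ (rs (⊐-· a⊐b a∶ u∶))

  Computable-⊒ : ∀ σ → a ∶ σ → a ⊒ b → Computable σ a → Computable σ b
  Computable-⊒ ι _ a⊒b = Terminating-⊒ a⊒b
  Computable-⊒ (α ⇒ β) a∶ a⊒b Ca u u∶ Cu = Computable-⊒ β (·-∶ a∶ u∶) (⊒-· a⊒b a∶ u∶) (Ca u u∶ Cu)

  -- Computability of variables

  infix 4 _⊐⋆_
  infixr 5 _⊐∷_ _⊒∷_
  data _⊐⋆_ : List Tm → List Tm → Set where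
    _⊐∷_ : a ⊐ b → Pointwise _⊒_ xs ys → a ∷ xs ⊐⋆ b ∷ ys
    _⊒∷_ : a ⊒ b → xs ⊐⋆ ys → a ∷ xs ⊐⋆ b ∷ ys

  TerminatingArgs : List Tm → Set
  TerminatingArgs = Acc (λ ys xs → xs ⊐⋆ ys)

  Pointwise-⊒⇒⊐⋆ : Pointwise _⊒_ xs ys → At xs i a → At ys i b → a ⊐ b → xs ⊐⋆ ys
  Pointwise-⊒⇒⊐⋆ (_ ∷ ps) here here a⊐b = a⊐b ⊐∷ ps
  Pointwise-⊒⇒⊐⋆ (p ∷ ps) (there ai) (there bi) a⊐b = p ⊒∷ Pointwise-⊒⇒⊐⋆ ps ai bi a⊐b

  Pointwise-⊒-split : Pointwise _⊒_ xs ys → Pointwise _≈_ xs ys ⊎ xs ⊐⋆ ys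
  Pointwise-⊒-split [] = inj₁ []
  Pointwise-⊒-split (⊒-⊐ p ∷ ps) = inj₂ (p ⊐∷ ps)
  Pointwise-⊒-split (⊒-≈ p ∷ ps) with Pointwise-⊒-split ps
  ... | inj₁ qs = inj₁ (p ∷ qs)
  ... | inj₂ r = inj₂ (⊒-≈ p ⊒∷ r)

  ≈-⊐⋆-trans : Pointwise _≈_ xs ys → ys ⊐⋆ zs → xs ⊐⋆ zs
  ≈-⊐⋆-trans (e ∷ es) (p ⊐∷ ps) = ≈-⊐-trans e p ⊐∷ ≈-⊒-trans-Pointwise es ps
  ≈-⊐⋆-trans (e ∷ es) (p ⊒∷ r) = ≈-⊒-trans e p ⊒∷ ≈-⊐⋆-trans es r

  TerminatingArgs-⊒ : TerminatingArgs xs → Pointwise _⊒_ xs ys → TerminatingArgs ys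
  TerminatingArgs-⊒ (acc rs) ps with Pointwise-⊒-split ps
  ... | inj₁ es = acc λ r → rs (≈-⊐⋆-trans es r)
  ... | inj₂ r = rs r

  -- Lexicographic in (Terminating a, TerminatingArgs xs); b stands for a term ≈-equivalent to a.
  mutual
    ∷-TerminatingArgs : Terminating a → TerminatingArgs xs → (b ⊐_) ⊆ (a ⊐_) → TerminatingArgs (b ∷ xs)
    ∷-TerminatingArgs A R b⊆a = acc (∷-TerminatingArgs-step A R b⊆a)

    ∷-TerminatingArgs-step : Terminating a → TerminatingArgs xs → (b ⊐_) ⊆ (a ⊐_) →
                             b ∷ xs ⊐⋆ ys → TerminatingArgs ys
    ∷-TerminatingArgs-step (acc ra) R b⊆a (b⊐c ⊐∷ ps) =
      ∷-TerminatingArgs (ra (b⊆a b⊐c)) (TerminatingArgs-⊒ R ps) (λ d → d)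
    ∷-TerminatingArgs-step (acc ra) (acc rr) b⊆a (⊒-⊐ b⊐c ⊒∷ r) =
      ∷-TerminatingArgs (ra (b⊆a b⊐c)) (rr r) (λ d → d)
    ∷-TerminatingArgs-step A (acc rr) b⊆a (⊒-≈ b≈c ⊒∷ r) =
      ∷-TerminatingArgs A (rr r) (λ c⊐d → b⊆a (≈-⊐-trans b≈c c⊐d))

  All-Terminating⇒TerminatingArgs : All Terminating xs → TerminatingArgs xs
  All-Terminating⇒TerminatingArgs [] = acc λ ()
  All-Terminating⇒TerminatingArgs (t ∷ ts) =
    ∷-TerminatingArgs t (All-Terminating⇒TerminatingArgs ts) (λ d → d)

  var-terminating : ∀ {n} → TerminatingArgs ss → Terminating (var ρ n ⟨ ss ⟩)
  var-terminating (acc rr) = acc λ where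
    (gr-mono _ ps (_ , _ , _ , ai , bi , a⊐b)) → var-terminating (rr (Pointwise-⊒⇒⊐⋆ ps ai bi a⊐b))
    (gr-rpo _ ())

  mutual
    var-computable : ∀ τ {n} → ArgsTy ρ ss τ → All Terminating ss → Computable τ (var ρ n ⟨ ss ⟩)
    var-computable ι _ Ts = var-terminating (All-Terminating⇒TerminatingArgs Ts)
    var-computable (α ⇒ β) p Ts u u∶ Cu =
      var-computable β (ArgsTy-++ p (u∶ ∷ [])) (All-++⁺ Ts (computable⇒terminating α u∶ Cu ∷ []))

    computable⇒terminating : ∀ σ → a ∶ σ → Computable σ a → Terminating a
    computable⇒terminating ι _ Ca = Ca
    computable⇒terminating (α ⇒ β) a∶ Ca =
      Terminating-·⁻¹ a∶ x∶ (computable⇒terminating β (·-∶ a∶ x∶) (Ca x x∶ (var-computable α [] [])))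
      where
      x : Tm
      x = var α 0 ⟨ [] ⟩
      x∶ : x ∶ α
      x∶ = tm []

  ComputableTm : Tm → Set
  ComputableTm u = ∀ σ → u ∶ σ → Computable σ u

  ComputableTm-intro : u ∶ σ → Computable σ u → ComputableTm u
  ComputableTm-intro {u = u} u∶ Cu σ u∶σ = subst (λ τ → Computable τ u) (∶-unique u∶ u∶σ) Cu

  ComputableTm-⊒ : a ⊒ b → ComputableTm a → ComputableTm b
  ComputableTm-⊒ {a = a} a⊒b Ca σ b∶ = Computable-⊒ σ a∶ a⊒b (Ca σ a∶)
    where
    a∶ : a ∶ σ
    a∶ = SameTy-∶ (SameTy-sym (⊒-SameTy a⊒b)) b∶

  Computable-++ : Computable ρ (hd ⟨ xs ⟩) → ArgsTy ρ ys σ → All ComputableTm ys →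
                  Computable σ (hd ⟨ xs ++ ys ⟩)
  Computable-++ {ρ = ρ} {hd = hd} {xs = xs} C [] [] =
    subst (λ zs → Computable ρ (hd ⟨ zs ⟩)) (sym (++-identityʳ xs)) C
  Computable-++ {hd = hd} {xs = xs} {ys = y ∷ ys} {σ = σ} C (y∶ ∷ p) (Cy ∷ Cys) =
    subst (λ zs → Computable σ (hd ⟨ zs ⟩)) (++-assoc xs [ y ] ys)
      (Computable-++ (C y y∶ (Cy _ y∶)) p Cys)

  saturated-terminating⇒computable :
    ∀ σ → (∀ us → ArgsTy σ us ι → All ComputableTm us → Terminating (hd ⟨ xs ++ us ⟩)) →
    Computable σ (hd ⟨ xs ⟩)
  saturated-terminating⇒computable {hd = hd} {xs = xs} ι T =
    subst (λ zs → Terminating (hd ⟨ zs ⟩)) (++-identityʳ xs) (T [] [] [])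
  saturated-terminating⇒computable {hd = hd} {xs = xs} (α ⇒ β) T u u∶ Cu =
    saturated-terminating⇒computable β λ us p Cus →
      subst (λ zs → Terminating (hd ⟨ zs ⟩)) (sym (++-assoc xs [ u ] us))
        (T (u ∷ us) (u∶ ∷ p) (ComputableTm-intro u∶ Cu ∷ Cus))

  -- The arguments outside p are replaced by (computable) variables.
  mask-unfiltered : (p : ℕ → Bool) → ArgsTy ρ ts σ →
                    (∀ i u → p i ≡ true → At ts i u → ComputableTm u) →
                    ∃ λ ts′ → ArgsTy ρ ts′ σ × All ComputableTm ts′ × PointwiseOn (λ i → p i ≡ true) _≈_ ts′ ts
  mask-unfiltered p [] _ = [] , [] , [] , λ _ _ _ _ ()
  mask-unfiltered {ts = t ∷ _} p (_∷_ {α = α} t∶ q) C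
    with mask-unfiltered (λ i → p (suc i)) q (λ i u Pi ui → C (suc i) u Pi (there ui)) | p 1 in p1
  ... | ts′ , q′ , Cts′ , ts′≈ts | true =
    t ∷ ts′ , t∶ ∷ q′ , C 1 t p1 here ∷ Cts′ , λ where
      _ _ _ _ here here → ≈-refl t∶
      (suc i) a b Pi (there ai) (there bi) → ts′≈ts i a b Pi ai bi
  ... | ts′ , q′ , Cts′ , ts′≈ts | false =
    var α 0 ⟨ [] ⟩ ∷ ts′ , tm [] ∷ q′ , ComputableTm-intro (tm []) (var-computable α [] []) ∷ Cts′ , λ where
      _ _ _ P1 here here → contradiction (trans (sym P1) p1) λ ()
      (suc i) a b Pi (there ai) (there bi) → ts′≈ts i a b Pi ai bi

  ComputableSym-app : ComputableSym g → ArgsTy (type g) ts σ →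
                      (∀ i u → π g i ≡ true → At ts i u → ComputableTm u) → Computable σ (fun g ⟨ ts ⟩)
  ComputableSym-app {g} {σ = σ} Cg p C with mask-unfiltered (π g) p C
  ... | ts′ , p′ , Cts′ , ts′≈ts = saturated-terminating⇒computable σ λ us q Cus →
    Terminating-≈
      (eq-args (ι , tm (ArgsTy-++ p′ q) , tm (ArgsTy-++ p q)) refl ≡ₚ-refl (λ _ → refl)
        (PointwiseOn-++ (ArgsTy-length p′ p) ts′≈ts (≈-refl-At q)))
      (Computable-++ Cg (ArgsTy-++ p′ q) (All-++⁺ Cts′ Cus))

  -- Lexicographic comparison of filtered argument lists

  filterFrom-suc : ∀ p k xs → filterFrom p (suc k) xs ≡ filterFrom (λ i → p (suc i)) k xs
  filterFrom-suc p k [] = refl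
  filterFrom-suc p k (x ∷ xs) rewrite filterFrom-suc p (suc k) xs = refl

  Lex-if : ∀ {L₁ L₂} bp bq → bp ≡ bq → (bp ≡ true → a ≈ b) → Lex L₁ L₂ →
           Lex (if bp then a ∷ L₁ else L₁) (if bq then b ∷ L₂ else L₂)
  Lex-if true _ refl a≈b lex = next (a≈b refl) lex
  Lex-if false _ refl _ lex = lex

  Lex-filterFrom : ∀ (p q : ℕ → Bool) → p i ≡ true → q i ≡ true →
                   (∀ j → 1 ≤ j → j ≤ i → p j ≡ q j) →
                   (∀ j a b → j < i → p j ≡ true → At xs j a → At ys j b → a ≈ b) →
                   At xs i a → At ys i b → a ⊐ b → Lex (filterFrom p 1 xs) (filterFrom q 1 ys)
  Lex-filterFrom p q Pi Qi _ _ here here a⊐b rewrite Pi | Qi = this a⊐b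
  Lex-filterFrom {xs = _ ∷ xs} {ys = _ ∷ ys} p q Pi Qi agree below (there ai) (there bi) a⊐b
    rewrite filterFrom-suc p 1 xs | filterFrom-suc q 1 ys =
    Lex-if (p 1) (q 1) (agree 1 (s≤s z≤n) (s≤s z≤n)) (λ P1 → below 1 _ _ (s≤s (At-pos ai)) P1 here here)
      (Lex-filterFrom (λ j → p (suc j)) (λ j → q (suc j)) Pi Qi
        (λ j _ j≤i → agree (suc j) (s≤s z≤n) (s≤s j≤i))
        (λ j a b j<i Pj aj bj → below (suc j) a b (s≤s j<i) Pj (there aj) (there bj))
        ai bi a⊐b)

  module _ {f : Sym} {ss : List Tm}
    (smaller-computable : ∀ g → f ▷ g → ComputableSym g)
    (args-computable : ∀ i u σ → π f i ≡ true → At ss i u → u ∶ σ → Computable σ u)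
    (lex-smaller-terminating : ∀ g ts ρ → f ≡ₚ g → fun g ⟨ ts ⟩ ∶ ρ →
                               Lex (filterπ f ss) (filterπ g ts) → Terminating (fun g ⟨ ts ⟩))
    where

    mutual
      ⊐⊐-computable : fun f ⟨ ss ⟩ ⊐⊐ a → ComputableTm a
      ⊐⊐-computable (rpo-select _ (i , b , Pi , bi , b⊒a)) =
        ComputableTm-⊒ b⊒a (λ σ → args-computable i b σ Pi bi)
      ⊐⊐-computable (rpo-appl {pre = pre} _ d ds) σ (tm p) =
        let (ρ , p₁ , p₂) = ArgsTy-split pre p in
        Computable-++ (⊐⊐-computable d ρ (tm p₁)) p₂ (⊐⊐-computable-All ds)
      ⊐⊐-computable (rpo-copy {g = g} _ f▷g K) σ (tm p) =
        ComputableSym-app (smaller-computable g f▷g) p (λ i u Pi ui → ⊐⊐-computable (K i u Pi ui))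
      ⊐⊐-computable (rpo-lex {g = g} {ts = ts} _ f≡g i Pfi Pgi agree below (_ , _ , ai , bi , a⊐b) _) σ (tm p) =
        saturated-terminating⇒computable σ λ us q _ →
          lex-smaller-terminating g (ts ++ us) ι f≡g (tm (ArgsTy-++ p q))
            (Lex-filterFrom (π f) (π g) Pfi Pgi agree
              (λ j a b j<i Pj aj bj → below j a b j<i Pj aj (At-++⁻ˡ bi j<i bj))
              ai (At-++ˡ bi) a⊐b)

      ⊐⊐-computable-All : All (fun f ⟨ ss ⟩ ⊐⊐_) xs → All ComputableTm xs
      ⊐⊐-computable-All [] = []
      ⊐⊐-computable-All (d ∷ ds) = ⊐⊐-computable d ∷ ⊐⊐-computable-All ds

lemma10 : (S : Signature) → let open Theory S in
    (f : Sym) (ss : List Tm) (τ : Ty) →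
    -- f s₁ ⋯ sₙ is well-typed (sᵢ :: σᵢ, n ≤ m)
    fun f ⟨ ss ⟩ ∶ τ →
    -- (1)
    (∀ g → f ▷ g → ComputableSym g) →
    -- (2)
    (∀ i u σ → π f i ≡ true → At ss i u → u ∶ σ → Computable σ u) →
    -- (3)
    (∀ g ts ρ → f ≡ₚ g → fun g ⟨ ts ⟩ ∶ ρ →
       Lex (filterπ f ss) (filterπ g ts) → Terminating (fun g ⟨ ts ⟩)) →
    -- conclusion
    ∀ t σ → t ∶ σ → fun f ⟨ ss ⟩ ⊐⊐ t → Computable σ t
lemma10 S _ _ _ _ smaller-computable args-computable lex-smaller-terminating _ σ t∶σ fs⊐⊐t =
  Computability.⊐⊐-computable S smaller-computable args-computable lex-smaller-terminating fs⊐⊐t σ t∶σ
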